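{- Let $D$ be a signed digraph on $[n]$ and $s\ge2$, and let \[ \phi:=\max_{0\le i\le n-1}\min\left\{\frac{n-d_i^0+1}{2},\ n-d_i^0-d_i^-+1,\ n-d_i^0-d_i^++1\right\}. \] Every code $\mathcal C\subseteq[s]^n$ with $d_{\mathrm m}(c,c')\ge\phi$ for all distinct $c,c'\in\mathcal C$ is a subset of $\mathrm{Fix}(f)$ for some $f\in F(D,s)$. Thus \[ g(D,s)\ge\log_s A_{\mathrm m}(n,\phi,s), \] and in particular \[ g(D,2)\ge\log_2 A_{\mathrm m}(n,\phi,2)\ge\log_2 A_{\mathrm H}(n,2\phi,\lfloor n/2\rfloor,2). \]
   Context: A signed digraph on $[n]=\{0,\dots,n-1\}$ is $D=([n],E,\lambda)$ with $E\subseteq[n]\times[n]$ (loops allowed) and $\lambda:E\to\{ -1,0,1\}$. For $i\in[n]$, $N^\alpha(i)=\{j:(j,i)\in E,\lambda(j,i)=\alpha\}$, $N(i)$ is their union, and $d_i^0=|N^0(i)|$, $d_i^+=|N^{1}(i)|$, $d_i^-=|N^{ -1}(i)|$. $[s]=\{0,\dots,s-1\}$. $F(D,s)$ is the set of maps $f:[s]^n\to[s]^n$ such that each $f_i$ depends only on $x_{N(i)}$, is non-decreasing in $x_j$ when $\lambda(j,i)=1$ and non-increasing in $x_j$ when $\lambda(j,i)=-1$; $\mathrm{Fix}(f)$ is its set of fixed points, $g(D,s)=\max_{f\in F(D,s)}\log_s|\mathrm{Fix}(f)|$. For $x,y\in[s]^n$, $L(x,y)=|\{i:x_i<y_i\}|$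 and $d_{\mathrm m}(x,y)=\min\{L(x,y),L(y,x)\}$. $A_{\mathrm m}(n,d,s)$ is the maximum cardinality of $\mathcal C\subseteq[s]^n$ with $d_{\mathrm m}(c,c')\ge d$ for all distinct $c,c'\in\mathcal C$. $A_{\mathrm H}(n,d,w,2)$ is the maximum cardinality of a set $\mathcal C\subseteq\{0,1\}^n$ all of whose elements have exactly $w$ ones and whose distinct elements differ in at least $d$ coordinates. -}

module Defs where

open import Data.Nat as ℕ using (ℕ; zero; suc; _+_; _*_; _∸_; _⊔_; _⊓_; _/_)
open import Data.Fin as Fin using (Fin)
open import Data.Vec using (Vec; lookup; allFin)
open import Data.Vec.Relation.Unary.Any using () renaming (Any to VAny)
open import Data.List using (List; length)
open import Data.List.Relation.Unary.All using (All)
open import Data.List.Relation.Unary.Unique.Propositional using (Unique)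
open import Data.List.Membership.Propositional using (_∈_)
open import Data.Maybe using (Maybe; just; nothing)
open import Data.Bool using (Bool; true; false; if_then_else_)
open import Data.Product using (Σ; _×_; ∃)
open import Relation.Binary.PropositionalEquality using (_≡_; _≢_)
open import Relation.Nullary using (¬_; does)
open import Data.Vec.Base using (foldr)
import Data.Vec.Base as V

data Sign : Set where
  neg zer pos : Sign

-- A signed digraph on [n]: arc j → i is present iff  arc j i ≡ just α,
-- and then α is its label λ(j,i).  Loops allowed (arc i i).
record SignedDigraph (n : ℕ) : Set where
  constructor mkSD
  field arc : Fin n → Fin n → Maybe Sign
open SignedDigraph public

isSign : Maybe Sign → Sign → Bool
isSign (just neg) neg = true
isSign (just zer) zer = true
isSign (just pos) pos = true
isSign _ _ = false

countFin : (n : ℕ) → (Fin n → Bool) → ℕ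
countFin n b = V.sum (V.map (λ k → if b k then 1 else 0) (allFin n))

deg : {n : ℕ} → SignedDigraph n → Sign → Fin n → ℕ
deg {n} D α i = countFin n (λ j → isSign (arc D j i) α)

InN : {n : ℕ} → SignedDigraph n → Fin n → Fin n → Set
InN D j i = Σ Sign (λ α → arc D j i ≡ just α)

Word : ℕ → ℕ → Set
Word n s = Vec (Fin s) n

-- maximum over i ∈ [n] of h i (0 for n = 0)
maxFin : (n : ℕ) → (Fin n → ℕ) → ℕ
maxFin n h = foldr (λ _ → ℕ) (λ k m → h k ⊔ m) 0 (allFin n)

-- 2φ (φ may be a half-integer; 2φ is a natural number since
-- d_i^0 + d_i^± ≤ n, so all subtractions below are exact)
twoPhi : {n : ℕ} → SignedDigraph n → ℕ
twoPhi {n} D = maxFin n (λ i →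
  (n ∸ deg D zer i + 1)
  ⊓ (2 * (n ∸ deg D zer i ∸ deg D neg i + 1))
  ⊓ (2 * (n ∸ deg D zer i ∸ deg D pos i + 1)))

Lcount : {n s : ℕ} → Word n s → Word n s → ℕ
Lcount {n} x y = countFin n (λ i → does (lookup x i Fin.<? lookup y i))

dm : {n s : ℕ} → Word n s → Word n s → ℕ
dm x y = Lcount x y ⊓ Lcount y x

dH : {n s : ℕ} → Word n s → Word n s → ℕ
dH {n} x y = countFin n (λ i → Data.Bool.not (does (lookup x i Fin.≟ lookup y i)))

weight : {n : ℕ} → Word n 2 → ℕ
weight {n} x = countFin n (λ i → does (lookup x i Fin.≟ Fin.suc Fin.zero))

DependsOnN : {n s : ℕ} → SignedDigraph n → (Word n s → Word n s) → Set
DependsOnN {n} {s} D f = ∀ (i : Fin n) (x y : Word n s) →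
  (∀ j → InN D j i → lookup x j ≡ lookup y j) → lookup (f x) i ≡ lookup (f y) i

LeAt : {n s : ℕ} → Fin n → Word n s → Word n s → Set
LeAt j x y = (lookup x j Fin.≤ lookup y j) × (∀ k → k ≢ j → lookup x k ≡ lookup y k)

Monotone : {n s : ℕ} → SignedDigraph n → (Word n s → Word n s) → Set
Monotone {n} {s} D f = ∀ (i j : Fin n) (x y : Word n s) → LeAt j x y →
  (arc D j i ≡ just pos → lookup (f x) i Fin.≤ lookup (f y) i) ×
  (arc D j i ≡ just neg → lookup (f y) i Fin.≤ lookup (f x) i)

InF : {n s : ℕ} → SignedDigraph n → (Word n s → Word n s) → Set
InF D f = DependsOnN D f × Monotone D f

-- a code (list of distinct words) with d_m(c,c') ≥ φ, i.e. 2 d_m ≥ 2φ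
MixedCode : {n s : ℕ} → (twoD : ℕ) → List (Word n s) → Set
MixedCode twoD C = Unique C ×
  (∀ c c' → c ∈ C → c' ∈ C → c ≢ c' → twoD ℕ.≤ 2 * dm c c')

CWCode : {n : ℕ} → (d w : ℕ) → List (Word n 2) → Set
CWCode d w C = Unique C × All (λ c → weight c ≡ w) C ×
  (∀ c c' → c ∈ C → c' ∈ C → c ≢ c' → d ℕ.≤ dH c c')

FixAtLeast : {n s : ℕ} → (Word n s → Word n s) → ℕ → Set
FixAtLeast {n} {s} f k = Σ (List (Word n s)) (λ P →
  Unique P × All (λ x → f x ≡ x) P × k ℕ.≤ length P)

module Submission where

-- Given a code C whose words are
-- pairwise at mixed distance ≥ φ, define f ∈ F(D,s) coordinatewise by
--     f(x)ᵢ = max { cᵢ : c ∈ C, c ≼ᵢ x }          (0 if there is none),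
-- where c ≼ᵢ x means that x agrees with c on the 0-in-neighbours of i, lies
-- above c on the positive ones and below c on the negative ones.  Such an f
-- depends only on x_{N(i)} and has the required monotonicity because
-- "c ≼ᵢ x" does.  Every c ∈ C is fixed, since no c' ≠ c in C satisfies
-- c' ≼ᵢ c: otherwise disjointness of the relevant coordinate sets gives
--   L(c',c)+d⁰+d⁻ ≤ n,  L(c,c')+d⁰+d⁺ ≤ n,  L(c',c)+L(c,c')+d⁰ ≤ n,
-- which force 2·d_m(c',c) < 2φ.

open import Defs
open import Data.Nat using (ℕ; _≤_; _/_)
open import Data.List using (List; length)
open import Data.List.Relation.Unary.All using (All)
open import Data.Product using (Σ; _×_)
open import Relation.Binary.PropositionalEquality using (_≡_)

open import Data.Nat using (zero; suc; _+_; _*_; _∸_; _⊓_; _⊔_; z≤n; s≤s; _<_)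
import Data.Nat.Properties as NP
open import Data.Fin as F using (Fin)
import Data.Fin.Properties as FP
open import Data.Vec as V using (Vec; lookup; tabulate; allFin)
import Data.Vec.Properties as VP
open import Data.Vec.Functional using (Vector)
open import Algebra.Properties.CommutativeMonoid.Sum NP.+-0-commutativeMonoid
  using (sum; sum-cong-≗; ∑-distrib-+)
open import Data.List using (filter; map)
import Data.List.Relation.Unary.All as All
open import Data.List.Membership.Propositional using (_∈_)
open import Data.List.Membership.Propositional.Properties
  using (∈-filter⁺; ∈-map⁺; ∈-map∘filter⁻)
open import Data.Maybe using (Maybe; just; nothing)
open import Data.Bool using (Bool; if_then_else_; not)
open import Data.Product using (_,_; proj₁)
open import Data.Unit using (⊤; tt)
open import Data.Empty using (⊥-elim)
open import Function using (_∘_)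
open import Relation.Nullary using (Dec; yes; no; does)
open import Relation.Binary.PropositionalEquality
  using (refl; sym; trans; cong; cong₂; subst; _≢_; module ≡-Reasoning)

ind : Bool → ℕ
ind b = if b then 1 else 0

countFin-sum : ∀ n (b : Fin n → Bool) → countFin n b ≡ sum (ind ∘ b)
countFin-sum n b = trans (cong V.sum (sym (VP.tabulate-allFin (ind ∘ b)))) (sum-tabulate n (ind ∘ b))
  where
  sum-tabulate : ∀ n (h : Vector ℕ n) → V.sum (tabulate h) ≡ sum h
  sum-tabulate zero    h = refl
  sum-tabulate (suc n) h = cong (h F.zero +_) (sum-tabulate n (h ∘ F.suc))

countFin-+ : ∀ n (a b : Fin n → Bool) →
  countFin n a + countFin n b ≡ sum (λ k → ind (a k) + ind (b k))
countFin-+ n a b = begin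
  countFin n a + countFin n b      ≡⟨ cong₂ _+_ (countFin-sum n a) (countFin-sum n b) ⟩
  sum (ind ∘ a) + sum (ind ∘ b)    ≡⟨ sym (∑-distrib-+ (ind ∘ a) (ind ∘ b)) ⟩
  sum (λ k → ind (a k) + ind (b k)) ∎
  where open ≡-Reasoning

sum-≤-length : ∀ {n} (h : Vector ℕ n) → (∀ k → h k ≤ 1) → sum h ≤ n
sum-≤-length {zero}  h h≤1 = z≤n
sum-≤-length {suc n} h h≤1 = NP.+-mono-≤ (h≤1 F.zero) (sum-≤-length (h ∘ F.suc) (h≤1 ∘ F.suc))

count-exclusive₃ : ∀ n (a b c : Fin n → Bool) →
  (∀ k → ind (a k) + ind (b k) + ind (c k) ≤ 1) →
  countFin n a + countFin n b + countFin n c ≤ n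
count-exclusive₃ n a b c excl = subst (_≤ n) (sym total) (sum-≤-length _ excl)
  where
  total : countFin n a + countFin n b + countFin n c
        ≡ sum (λ k → ind (a k) + ind (b k) + ind (c k))
  total = begin
    countFin n a + countFin n b + countFin n c
      ≡⟨ cong₂ _+_ (countFin-+ n a b) (countFin-sum n c) ⟩
    sum (λ k → ind (a k) + ind (b k)) + sum (ind ∘ c)
      ≡⟨ sym (∑-distrib-+ (λ k → ind (a k) + ind (b k)) (ind ∘ c)) ⟩
    sum (λ k → ind (a k) + ind (b k) + ind (c k)) ∎
    where open ≡-Reasoning

count-balance : ∀ n (a b c d : Fin n → Bool) →
  (∀ k → ind (a k) + ind (b k) ≡ ind (c k) + ind (d k)) →
  countFin n a + countFin n b ≡ countFin n c + countFin n d
count-balance n a b c d bal =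
  trans (countFin-+ n a b) (trans (sum-cong-≗ bal) (sym (countFin-+ n c d)))

maxFin-upper : ∀ n (h : Fin n → ℕ) i → h i ≤ maxFin n h
maxFin-upper n h i = subst (λ j → h j ≤ maxFin n h) (VP.lookup-allFin i) (foldr-upper (allFin n) i)
  where
  foldr-upper : ∀ {m} (v : Vec (Fin n) m) (k : Fin m) →
    h (lookup v k) ≤ V.foldr (λ _ → ℕ) (λ j r → h j ⊔ r) 0 v
  foldr-upper (j V.∷ v) F.zero    = NP.m≤m⊔n (h j) _
  foldr-upper (j V.∷ v) (F.suc k) = NP.m≤n⇒m≤o⊔n (h j) (foldr-upper v k)

phiBound : (n d0 dn dp : ℕ) → ℕ
phiBound n d0 dn dp = (n ∸ d0 + 1) ⊓ (2 * (n ∸ d0 ∸ dn + 1)) ⊓ (2 * (n ∸ d0 ∸ dp + 1))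

phiTerm : ∀ {n} → SignedDigraph n → Fin n → ℕ
phiTerm {n} D i = phiBound n (deg D zer i) (deg D neg i) (deg D pos i)

phiTerm≤twoPhi : ∀ {n} (D : SignedDigraph n) i → phiTerm D i ≤ twoPhi D
phiTerm≤twoPhi {n} D i = maxFin-upper n (phiTerm D) i

min-below-phiBound : ∀ n d0 dn dp L1 L2 →
  L1 + d0 + dn ≤ n → L2 + d0 + dp ≤ n → L1 + L2 + d0 ≤ n →
  2 * (L1 ⊓ L2) < phiBound n d0 dn dp
min-below-phiBound n d0 dn dp L1 L2 h₁ h₂ h₃ =
  NP.⊓-glb (NP.⊓-glb below-first (below-signed L1 _ (NP.m⊓n≤m L1 L2) (subtract L1 d0 dn h₁)))
           (below-signed L2 _ (NP.m⊓n≤n L1 L2) (subtract L2 d0 dp h₂))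
  where
  m = L1 ⊓ L2
  twice-min : 2 * m ≤ L1 + L2
  twice-min = subst (_≤ L1 + L2) (cong (m +_) (sym (NP.+-identityʳ m)))
                (NP.+-mono-≤ (NP.m⊓n≤m L1 L2) (NP.m⊓n≤n L1 L2))
  below-first : 2 * m < n ∸ d0 + 1
  below-first = NP.≤-<-trans twice-min
    (NP.≤-<-trans (NP.m+n≤o⇒m≤o∸n (L1 + L2) h₃) (NP.m<m+n _ (s≤s z≤n)))
  subtract : ∀ L d e → L + d + e ≤ n → L ≤ n ∸ d ∸ e
  subtract L d e h = subst (L ≤_) (sym (NP.∸-+-assoc n d e))
    (NP.m+n≤o⇒m≤o∸n L (subst (_≤ n) (NP.+-assoc L d e) h))
  below-signed : ∀ L X → m ≤ L → L ≤ X → 2 * m < 2 * (X + 1)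
  below-signed L X m≤L L≤X =
    NP.*-monoʳ-< 2 (NP.≤-<-trans (NP.≤-trans m≤L L≤X) (NP.m<m+n X (s≤s z≤n)))

module Domination {n s : ℕ} (D : SignedDigraph n) where

  -- Compatible m a b: the value b is admissible for x_k when c_k = a and
  -- the arc k → i carries m: equal on 0-arcs, above on +, below on −.
  Compatible : Maybe Sign → Fin s → Fin s → Set
  Compatible (just zer) a b = b ≡ a
  Compatible (just pos) a b = a F.≤ b
  Compatible (just neg) a b = b F.≤ a
  Compatible nothing    a b = ⊤

  compatible? : ∀ m a b → Dec (Compatible m a b)
  compatible? (just zer) a b = b F.≟ a
  compatible? (just pos) a b = a F.≤? b
  compatible? (just neg) a b = b F.≤? a
  compatible? nothing    a b = yes tt

  compatible-refl : ∀ m a → Compatible m a a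
  compatible-refl (just zer) a = refl
  compatible-refl (just pos) a = NP.≤-refl
  compatible-refl (just neg) a = NP.≤-refl
  compatible-refl nothing    a = tt

  _≼[_]_ : Word n s → Fin n → Word n s → Set
  c ≼[ i ] x = ∀ k → Compatible (arc D k i) (lookup c k) (lookup x k)

  dominated? : ∀ i c x → Dec (c ≼[ i ] x)
  dominated? i c x = FP.all? (λ k → compatible? (arc D k i) (lookup c k) (lookup x k))

  ≼-refl : ∀ i c → c ≼[ i ] c
  ≼-refl i c k = compatible-refl (arc D k i) (lookup c k)

  ≼-local : ∀ i {c x y} → (∀ k → InN D k i → lookup x k ≡ lookup y k) →
    c ≼[ i ] x → c ≼[ i ] y
  ≼-local i {c} agree c≼x k with arc D k i in arc≡ | c≼x k
  ... | nothing | _    = tt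
  ... | just α  | comp = subst (Compatible (just α) (lookup c k)) (agree k (α , arc≡)) comp

  compatible-up : ∀ m {a b c : Fin s} → m ≡ just pos → a F.≤ b →
    Compatible m c a → Compatible m c b
  compatible-up .(just pos) refl a≤b c≤a = NP.≤-trans c≤a a≤b

  compatible-down : ∀ m {a b c : Fin s} → m ≡ just neg → a F.≤ b →
    Compatible m c b → Compatible m c a
  compatible-down .(just neg) refl a≤b b≤c = NP.≤-trans a≤b b≤c

  ≼-update : ∀ i j {c x y} → (∀ k → k ≢ j → lookup x k ≡ lookup y k) →
    (Compatible (arc D j i) (lookup c j) (lookup x j) →
     Compatible (arc D j i) (lookup c j) (lookup y j)) →
    c ≼[ i ] x → c ≼[ i ] y
  ≼-update i j {c} same step c≼x k with k F.≟ j
  ... | yes refl = step (c≼x k)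
  ... | no k≢j   = subst (Compatible (arc D k i) (lookup c k)) (same k k≢j) (c≼x k)

  exclusive-below : ∀ m {a b : Fin s} → Compatible m a b → (d : Dec (a F.< b)) →
    ind (does d) + ind (isSign m zer) + ind (isSign m neg) ≤ 1
  exclusive-below (just zer) refl (yes a<a) = ⊥-elim (FP.<-irrefl refl a<a)
  exclusive-below (just neg) b≤a  (yes a<b) = ⊥-elim (NP.<⇒≱ a<b b≤a)
  exclusive-below (just pos) _    (yes _)   = NP.≤-refl
  exclusive-below nothing    _    (yes _)   = NP.≤-refl
  exclusive-below (just zer) _    (no _)    = NP.≤-refl
  exclusive-below (just neg) _    (no _)    = NP.≤-refl
  exclusive-below (just pos) _    (no _)    = z≤n
  exclusive-below nothing    _    (no _)    = z≤n

  exclusive-above : ∀ m {a b : Fin s} → Compatible m a b → (d : Dec (b F.< a)) →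
    ind (does d) + ind (isSign m zer) + ind (isSign m pos) ≤ 1
  exclusive-above (just zer) refl (yes a<a) = ⊥-elim (FP.<-irrefl refl a<a)
  exclusive-above (just pos) a≤b  (yes b<a) = ⊥-elim (NP.<⇒≱ b<a a≤b)
  exclusive-above (just neg) _    (yes _)   = NP.≤-refl
  exclusive-above nothing    _    (yes _)   = NP.≤-refl
  exclusive-above (just zer) _    (no _)    = NP.≤-refl
  exclusive-above (just pos) _    (no _)    = NP.≤-refl
  exclusive-above (just neg) _    (no _)    = z≤n
  exclusive-above nothing    _    (no _)    = z≤n

  exclusive-strict : ∀ m {a b : Fin s} → Compatible m a b →
    (d : Dec (a F.< b)) → (d' : Dec (b F.< a)) →
    ind (does d) + ind (does d') + ind (isSign m zer) ≤ 1
  exclusive-strict _          _    (yes a<b) (yes b<a) = ⊥-elim (FP.<-asym a<b b<a)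
  exclusive-strict (just zer) refl (yes a<a) (no _)    = ⊥-elim (FP.<-irrefl refl a<a)
  exclusive-strict (just zer) refl (no _)    (yes a<a) = ⊥-elim (FP.<-irrefl refl a<a)
  exclusive-strict (just zer) _    (no _)    (no _)    = NP.≤-refl
  exclusive-strict (just pos) _    (yes _)   (no _)    = NP.≤-refl
  exclusive-strict (just neg) _    (yes _)   (no _)    = NP.≤-refl
  exclusive-strict nothing    _    (yes _)   (no _)    = NP.≤-refl
  exclusive-strict (just pos) _    (no _)    (yes _)   = NP.≤-refl
  exclusive-strict (just neg) _    (no _)    (yes _)   = NP.≤-refl
  exclusive-strict nothing    _    (no _)    (yes _)   = NP.≤-refl
  exclusive-strict (just pos) _    (no _)    (no _)    = z≤n
  exclusive-strict (just neg) _    (no _)    (no _)    = z≤n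
  exclusive-strict nothing    _    (no _)    (no _)    = z≤n

  dominated⇒close : ∀ i c' c → c' ≼[ i ] c → 2 * dm c' c < phiTerm D i
  dominated⇒close i c' c c'≼c =
    min-below-phiBound n (deg D zer i) (deg D neg i) (deg D pos i) (Lcount c' c) (Lcount c c')
      (count-exclusive₃ n below zero-arc neg-arc
        (λ k → exclusive-below (arc D k i) (c'≼c k) (lookup c' k F.<? lookup c k)))
      (count-exclusive₃ n above zero-arc pos-arc
        (λ k → exclusive-above (arc D k i) (c'≼c k) (lookup c k F.<? lookup c' k)))
      (count-exclusive₃ n below above zero-arc
        (λ k → exclusive-strict (arc D k i) (c'≼c k)
                 (lookup c' k F.<? lookup c k) (lookup c k F.<? lookup c' k)))
    where
    below above zero-arc neg-arc pos-arc : Fin n → Bool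
    below    k = does (lookup c' k F.<? lookup c k)
    above    k = does (lookup c k F.<? lookup c' k)
    zero-arc k = isSign (arc D k i) zer
    neg-arc  k = isSign (arc D k i) neg
    pos-arc  k = isSign (arc D k i) pos

Rigid : ∀ {n s} → SignedDigraph n → List (Word n s) → Set
Rigid D C = ∀ i {c c'} → c ∈ C → c' ∈ C → Domination._≼[_]_ D c' i c → c' ≡ c

mixed⇒rigid : ∀ {n s} (D : SignedDigraph n) (C : List (Word n s)) →
  MixedCode (twoPhi D) C → Rigid D C
mixed⇒rigid D C (_ , far) i {c} {c'} c∈C c'∈C c'≼c with VP.≡-dec F._≟_ c' c
... | yes c'≡c = c'≡c
... | no  c'≢c = ⊥-elim (NP.<-irrefl refl (begin-strict
  twoPhi D           ≤⟨ far c' c c'∈C c∈C c'≢c ⟩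
  2 * dm c' c        <⟨ Domination.dominated⇒close D i c' c c'≼c ⟩
  phiTerm D i        ≤⟨ phiTerm≤twoPhi D i ⟩
  twoPhi D           ∎))
  where open NP.≤-Reasoning

module Network {n s' : ℕ} (D : SignedDigraph n) (C : List (Word n (suc s'))) where

  open Domination {s = suc s'} D
  open import Data.List.Extrema (FP.≤-totalOrder (suc s')) using (max; max-mono-⊆; max≈v⁺)
  open import Data.List.Relation.Binary.Subset.Propositional using (_⊆_)

  private
    s = suc s'

  dominatedValues : Fin n → Word n s → List (Fin s)
  dominatedValues i x = map (λ c → lookup c i) (filter (λ c → dominated? i c x) C)

  level : Fin n → Word n s → Fin s
  level i x = max F.zero (dominatedValues i x)

  f : Word n s → Word n s
  f x = tabulate (λ i → level i x)

  f-coord : ∀ x i → lookup (f x) i ≡ level i x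
  f-coord x i = VP.lookup∘tabulate (λ i → level i x) i

  -- If every codeword dominated by x at i is dominated by y at i, then
  -- f(x)ᵢ ≤ f(y)ᵢ; both locality and monotonicity of f reduce to this.
  level-mono : ∀ i x y → (∀ c → c ≼[ i ] x → c ≼[ i ] y) →
    lookup (f x) i F.≤ lookup (f y) i
  level-mono i x y imp rewrite f-coord x i | f-coord y i = max-mono-⊆ z≤n values⊆
    where
    values⊆ : dominatedValues i x ⊆ dominatedValues i y
    values⊆ v∈ with ∈-map∘filter⁻ (λ c → lookup c i) (λ c → dominated? i c x) {xs = C} v∈
    ... | c , c∈C , refl , c≼x =
      ∈-map⁺ (λ c → lookup c i) (∈-filter⁺ (λ c → dominated? i c y) c∈C (imp c c≼x))

  f∈F : InF D f
  f∈F = local , monotone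
    where
    local : DependsOnN D f
    local i x y agree =
      FP.≤-antisym (level-mono i x y (λ c → ≼-local i {c} {x} {y} agree))
                   (level-mono i y x (λ c → ≼-local i {c} {y} {x} (λ k e → sym (agree k e))))
    monotone : Monotone D f
    monotone i j x y (x≤y , same) =
      (λ arc≡ → level-mono i x y (λ c → ≼-update i j {c} {x} {y} same
                                           (compatible-up _ arc≡ x≤y))) ,
      (λ arc≡ → level-mono i y x (λ c → ≼-update i j {c} {y} {x} (λ k k≢j → sym (same k k≢j))
                                           (compatible-down _ arc≡ x≤y)))

  -- Every codeword c of a rigid code is a fixed point of f: its own value cᵢ
  -- is the only one contributing to f(c)ᵢ.
  rigid⇒fixed : Rigid D C → All (λ c → f c ≡ c) C
  rigid⇒fixed rigid = All.tabulate (λ {c} c∈C →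
    trans (VP.tabulate-cong (level-self c c∈C)) (VP.tabulate∘lookup c))
    where
    level-self : ∀ c → c ∈ C → ∀ i → level i c ≡ lookup c i
    level-self c c∈C i = max≈v⁺ own-value (All.tabulate only-own) z≤n
      where
      own-value : lookup c i ∈ dominatedValues i c
      own-value = ∈-map⁺ (λ c → lookup c i) (∈-filter⁺ (λ c' → dominated? i c' c) c∈C (≼-refl i c))
      only-own : ∀ {v} → v ∈ dominatedValues i c → v F.≤ lookup c i
      only-own v∈ with ∈-map∘filter⁻ (λ c → lookup c i) (λ c' → dominated? i c' c) {xs = C} v∈
      ... | c' , c'∈C , refl , c'≼c with rigid i c∈C c'∈C c'≼c
      ... | refl = NP.≤-refl

one-plus-below : ∀ (a b : Fin 2) →
  ind (does (a F.≟ F.suc F.zero)) + ind (does (a F.<? b))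
  ≡ ind (does (b F.≟ F.suc F.zero)) + ind (does (b F.<? a))
one-plus-below F.zero           F.zero           = refl
one-plus-below F.zero           (F.suc F.zero)   = refl
one-plus-below (F.suc F.zero)   F.zero           = refl
one-plus-below (F.suc F.zero)   (F.suc F.zero)   = refl

differ-split : ∀ {s} (a b : Fin s) (e : Dec (a ≡ b)) (d : Dec (a F.< b)) (d' : Dec (b F.< a)) →
  ind (not (does e)) ≡ ind (does d) + ind (does d')
differ-split a b (yes refl) (yes a<a) _         = ⊥-elim (FP.<-irrefl refl a<a)
differ-split a b (yes refl) (no _)    (yes a<a) = ⊥-elim (FP.<-irrefl refl a<a)
differ-split a b (yes _)    (no _)    (no _)    = refl
differ-split a b (no _)     (yes a<b) (yes b<a) = ⊥-elim (FP.<-asym a<b b<a)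
differ-split a b (no _)     (yes _)   (no _)    = refl
differ-split a b (no _)     (no _)    (yes _)   = refl
differ-split a b (no a≢b)   (no a≮b)  (no b≮a)  =
  ⊥-elim (a≢b (FP.≤-antisym (NP.≮⇒≥ b≮a) (NP.≮⇒≥ a≮b)))

-- The counting form: words of equal weight have L(x,y) = L(y,x), hence
-- d_H(x,y) = L(x,y) + L(y,x) = 2·d_m(x,y).
equal-weight⇒dH≡2dm : ∀ {n} (x y : Word n 2) → weight x ≡ weight y → dH x y ≡ 2 * dm x y
equal-weight⇒dH≡2dm {n} x y same-weight = begin
  dH x y                          ≡⟨ countFin-sum n differ ⟩
  sum (ind ∘ differ)              ≡⟨ sum-cong-≗ (λ k → differ-split (lookup x k) (lookup y k)
                                      (lookup x k F.≟ lookup y k)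
                                      (lookup x k F.<? lookup y k) (lookup y k F.<? lookup x k)) ⟩
  sum (λ k → ind (below k) + ind (above k)) ≡⟨ sym (countFin-+ n below above) ⟩
  Lcount x y + Lcount y x         ≡⟨ cong (Lcount x y +_) (sym L-symmetric) ⟩
  Lcount x y + Lcount x y         ≡⟨ cong (Lcount x y +_) (sym (NP.+-identityʳ _)) ⟩
  2 * Lcount x y                  ≡⟨ cong (2 *_) (sym dm≡L) ⟩
  2 * dm x y                      ∎
  where
  open ≡-Reasoning
  differ below above : Fin n → Bool
  differ k = not (does (lookup x k F.≟ lookup y k))
  below  k = does (lookup x k F.<? lookup y k)
  above  k = does (lookup y k F.<? lookup x k)
  L-symmetric : Lcount x y ≡ Lcount y x
  L-symmetric = NP.+-cancelˡ-≡ (weight y) _ _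
    (trans (cong (_+ Lcount x y) (sym same-weight))
           (count-balance n _ below _ above (λ k → one-plus-below (lookup x k) (lookup y k))))
  dm≡L : dm x y ≡ Lcount x y
  dm≡L = trans (cong (Lcount x y ⊓_) (sym L-symmetric)) (NP.⊓-idem _)

constantWeight⇒mixed : ∀ {n} (twoD w : ℕ) (C : List (Word n 2)) →
  CWCode twoD w C → MixedCode twoD C
constantWeight⇒mixed twoD w C (unique , weights , far) = unique , λ c c' c∈C c'∈C c≢c' →
  subst (twoD ≤_)
    (equal-weight⇒dH≡2dm c c' (trans (All.lookup weights c∈C) (sym (All.lookup weights c'∈C))))
    (far c c' c∈C c'∈C c≢c')

mixed⇒fixed : ∀ {n s} → 2 ≤ s → (D : SignedDigraph n) → (C : List (Word n s)) →
  MixedCode (twoPhi D) C → Σ (Word n s → Word n s) (λ f → InF D f × All (λ c → f c ≡ c) C)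
mixed⇒fixed (s≤s _) D C mixed =
  Network.f D C , Network.f∈F D C , Network.rigid⇒fixed D C (mixed⇒rigid D C mixed)

mixed⇒manyFixed : ∀ {n s} → 2 ≤ s → (D : SignedDigraph n) → (C : List (Word n s)) →
  MixedCode (twoPhi D) C → Σ (Word n s → Word n s) (λ f → InF D f × FixAtLeast f (length C))
mixed⇒manyFixed 2≤s D C mixed with mixed⇒fixed 2≤s D C mixed
... | f , f∈F , fixed = f , f∈F , C , proj₁ mixed , fixed , NP.≤-refl

theorem5 : (n s : ℕ) → 2 ≤ s → (D : SignedDigraph n) →
    ((C : List (Word n s)) → MixedCode (twoPhi D) C →
      Σ (Word n s → Word n s) (λ f → InF D f × All (λ c → f c ≡ c) C))
    × ((C : List (Word n s)) → MixedCode (twoPhi D) C →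
      Σ (Word n s → Word n s) (λ f → InF D f × FixAtLeast f (length C)))
    × ((C : List (Word n 2)) → MixedCode (twoPhi D) C →
      Σ (Word n 2 → Word n 2) (λ f → InF D f × FixAtLeast f (length C)))
    × ((C : List (Word n 2)) → CWCode (twoPhi D) (n / 2) C →
      Σ (List (Word n 2)) (λ C' → MixedCode (twoPhi D) C' × length C ≤ length C'))
theorem5 n s 2≤s D =
  mixed⇒fixed 2≤s D ,
  mixed⇒manyFixed 2≤s D ,
  mixed⇒manyFixed (s≤s (s≤s z≤n)) D ,
  λ C cw → C , constantWeight⇒mixed (twoPhi D) (n / 2) C cw , NP.≤-refl
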